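{- If $T$ is a finite bicentric tree, then $D(T) \le D'(T) \le D(T)+1$.
   Context: A tree is bicentric if its center (the subgraph induced by the vertices of minimum eccentricity) consists of two adjacent vertices. $D(G)$ (the distinguishing number) is the least number $r$ of labels in a vertex labeling $V(G)\to\{1,\dots,r\}$ preserved by no non-identity automorphism of $G$; $D'(G)$ (the distinguishing index) is the least number of labels in an edge labeling preserved by no non-identity automorphism of $G$. -}

module Defs where

open import Data.Nat using (ℕ; zero; suc; _≤_; _<_)
open import Data.Fin using (Fin)
open import Data.Bool using (Bool; T)
open import Data.List using (List; []; _∷_; length)
open import Data.List.Relation.Unary.Unique.Propositional using (Unique)
open import Data.Product using (Σ; ∃; ∃-syntax; _×_; _,_)
open import Data.Sum using (_⊎_)
open import Data.Empty using (⊥)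
open import Data.Unit using (⊤)
open import Relation.Nullary using (¬_)
open import Relation.Binary.PropositionalEquality using (_≡_; _≢_)
open import Data.Fin.Permutation using (Permutation′; _⟨$⟩ʳ_)

record Graph (n : ℕ) : Set where
  field
    adj    : Fin n → Fin n → Bool
    sym    : ∀ u v → T (adj u v) → T (adj v u)
    irrefl : ∀ v → ¬ T (adj v v)

module _ {n : ℕ} (G : Graph n) where
  open Graph G

  E : Fin n → Fin n → Set
  E u v = T (adj u v)

  data Walk : Fin n → Fin n → ℕ → Set where
    here : ∀ {v} → Walk v v zero
    step : ∀ {u w v k} → E u w → Walk w v k → Walk u v (suc k)

  Connected : Set
  Connected = ∀ u v → ∃[ k ] Walk u v k

  PathList : List (Fin n) → Set
  PathList [] = ⊤
  PathList (v ∷ []) = ⊤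
  PathList (u ∷ v ∷ vs) = E u v × PathList (v ∷ vs)

  record Cycle : Set where
    field
      first : Fin n
      rest  : List (Fin n)
      last  : Fin n
      long  : 3 ≤ length (first ∷ rest Data.List.++ (last ∷ []))
      path  : PathList (first ∷ rest Data.List.++ (last ∷ []))
      distinct : Unique (first ∷ rest Data.List.++ (last ∷ []))
      closes : E last first

  Acyclic : Set
  Acyclic = ¬ Cycle

  IsTree : Set
  IsTree = Connected × Acyclic

  Dist : Fin n → Fin n → ℕ → Set
  Dist u v d = Walk u v d × (∀ k → Walk u v k → d ≤ k)

  Ecc : Fin n → ℕ → Set
  Ecc v e = (∀ u → ∃[ d ] (Dist v u d × d ≤ e)) × (∃[ u ] Dist v u e)

  InCenter : Fin n → Set
  InCenter v = ∃[ e ] (Ecc v e × (∀ w e′ → Ecc w e′ → e ≤ e′))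

  Bicentric : Set
  Bicentric = ∃[ a ] ∃[ b ] (a ≢ b × E a b × InCenter a × InCenter b
                × (∀ c → InCenter c → c ≡ a ⊎ c ≡ b))

  IsAutomorphism : Permutation′ n → Set
  IsAutomorphism σ = ∀ u v → (E u v → E (σ ⟨$⟩ʳ u) (σ ⟨$⟩ʳ v))
                            × (E (σ ⟨$⟩ʳ u) (σ ⟨$⟩ʳ v) → E u v)

  NonIdentity : Permutation′ n → Set
  NonIdentity σ = ∃[ v ] (σ ⟨$⟩ʳ v ≢ v)

  PreservesVertexLabelling : ∀ {r} → (Fin n → Fin r) → Permutation′ n → Set
  PreservesVertexLabelling c σ = ∀ v → c (σ ⟨$⟩ʳ v) ≡ c v

  DistinguishingVertexLabelling : ∀ {r} → (Fin n → Fin r) → Set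
  DistinguishingVertexLabelling c =
    ∀ σ → IsAutomorphism σ → NonIdentity σ → ¬ PreservesVertexLabelling c σ

  -- An edge labelling with r labels: a function on ordered pairs whose
  -- values on edges are symmetric (values on non-edges are irrelevant).
  EdgeLabelling : ℕ → Set
  EdgeLabelling r = Σ (Fin n → Fin n → Fin r) λ ℓ → ∀ u v → E u v → ℓ u v ≡ ℓ v u

  PreservesEdgeLabelling : ∀ {r} → EdgeLabelling r → Permutation′ n → Set
  PreservesEdgeLabelling (ℓ , _) σ = ∀ u v → E u v → ℓ (σ ⟨$⟩ʳ u) (σ ⟨$⟩ʳ v) ≡ ℓ u v

  DistinguishingEdgeLabelling : ∀ {r} → EdgeLabelling r → Set
  DistinguishingEdgeLabelling ℓ =
    ∀ σ → IsAutomorphism σ → NonIdentity σ → ¬ PreservesEdgeLabelling ℓ σ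

  HasDistVertexLabelling : ℕ → Set
  HasDistVertexLabelling r = Σ (Fin n → Fin r) DistinguishingVertexLabelling

  HasDistEdgeLabelling : ℕ → Set
  HasDistEdgeLabelling r = Σ (EdgeLabelling r) DistinguishingEdgeLabelling

  IsDistinguishingNumber : ℕ → Set
  IsDistinguishingNumber r = HasDistVertexLabelling r × (∀ s → HasDistVertexLabelling s → r ≤ s)

  IsDistinguishingIndex : ℕ → Set
  IsDistinguishingIndex r = HasDistEdgeLabelling r × (∀ s → HasDistEdgeLabelling s → r ≤ s)

-- Root the tree at its central edge ab: every vertex v has a parent, its unique neighbor one
-- step closer to ab (the parent of a is b and vice versa), and every edge joins a vertex to its
-- parent. An automorphism maps the center {a, b} to itself, so it preserves depths and commutes
-- with taking parents. Hence labelling each vertex by the edge to its parent turns a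
-- distinguishing edge labelling into a distinguishing vertex labelling: D ≤ D′. Conversely, label
-- each edge by its endpoint farther from ab, using one extra label for ab and for one neighbor x
-- of the center outside it. An automorphism preserving this labelling fixes x, so it cannot swap
-- a and b (x would be a common neighbor of a and b, closing a triangle); it therefore fixes a and
-- b and preserves the vertex labelling: D′ ≤ D + 1. The neighbor x exists, since the single edge
-- has no distinguishing edge labelling at all.

module Submission where

open import Defs
open import Data.Nat using (ℕ; zero; suc; pred; _≤_; _<_; z≤n; s≤s)
open import Data.Nat.Properties
  using (≤-reflexive; ≤-trans; ≤-antisym; m≤n+m; m≤n⇒m≤1+n; pred-mono-≤; <-cmp; <-irrefl)
open import Data.Fin using (Fin; fromℕ; inject₁; _≟_)
open import Data.Fin.Properties using (any?; fromℕ≢inject₁; inject₁-injective)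
open import Data.Fin.Permutation using (Permutation′; _⟨$⟩ʳ_; _⟨$⟩ˡ_; inverseˡ; inverseʳ; flip; transpose)
open import Data.List using (List; []; _∷_; _++_; length)
open import Data.List.Properties using (length-++)
open import Data.List.Relation.Unary.All using (All; []; _∷_) renaming (map to All-map)
import Data.List.Relation.Unary.All.Properties as All
open import Data.List.Relation.Unary.AllPairs using ([]; _∷_)
import Data.List.Relation.Unary.AllPairs.Properties as AllPairs
open import Data.List.Relation.Unary.Unique.Propositional using (Unique)
open import Data.Product using (∃-syntax; ∃₂; _×_; _,_; proj₁; proj₂)
open import Data.Sum using (_⊎_; inj₁; inj₂)
import Data.Sum as Sum
open import Function using (_∘_; Injection)
open import Function.Properties.Inverse using (↔⇒↣)
open import Data.Empty using (⊥)
open import Data.Unit using (tt)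
open import Relation.Nullary using (¬_; Dec; yes; no; contradiction)
open import Relation.Nullary.Decidable using (T?; _×-dec_; _⊎-dec_; ¬?; dec-true; dec-false)
open import Relation.Unary using (Decidable)
open import Relation.Binary.PropositionalEquality
  using (_≡_; _≢_; ≢-sym; refl; sym; trans; cong; subst; subst₂; module ≡-Reasoning)
open import Relation.Binary.Definitions using (tri<; tri≈; tri>)

least : ∀ {p} {P : ℕ → Set p} → Decidable P → ∀ {k} → P k → ∃[ m ] (P m × (∀ {j} → P j → m ≤ j))
least P? {zero} p0 = 0 , p0 , λ _ → z≤n
least {P = P} P? {suc k} pk with P? 0
... | yes p0 = 0 , p0 , λ _ → z≤n
... | no ¬p0 with least (λ j → P? (suc j)) pk
...   | m , pm , minimal = suc m , pm , above
  where
  above : ∀ {j} → P j → suc m ≤ j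
  above {zero} p0 = contradiction p0 ¬p0
  above {suc j} pj = s≤s (minimal pj)

module _ {n : ℕ} (G : Graph n) where

  edge-sym : ∀ {u v} → E G u v → E G v u
  edge-sym = Graph.sym G _ _

  walk? : ∀ u v k → Dec (Walk G u v k)
  walk? u v zero with u ≟ v
  ... | yes refl = yes here
  ... | no u≢v = no λ { here → u≢v refl }
  walk? u v (suc k) with any? (λ w → T? (Graph.adj G u w) ×-dec walk? w v k)
  ... | yes (w , e , walk) = yes (step e walk)
  ... | no none = no λ { (step e walk) → none (_ , e , walk) }

  adjacent⇒≢ : ∀ {u v} → E G u v → u ≢ v
  adjacent⇒≢ e refl = Graph.irrefl G _ e

  route : Fin n → List (Fin n) → Fin n → List (Fin n)
  route x zs y = x ∷ zs ++ y ∷ []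

  SimplePath : Fin n → List (Fin n) → Fin n → Set
  SimplePath x zs y = PathList G (route x zs y) × Unique (route x zs y)

  edge-path : ∀ {x y} → x ≢ y → E G x y → SimplePath x [] y
  edge-path x≢y e = (e , tt) , (x≢y ∷ []) ∷ [] ∷ []

  cons-path : ∀ {w x zs y} → E G w x → All (w ≢_) (route x zs y) →
              SimplePath x zs y → SimplePath w (x ∷ zs) y
  cons-path e w∉ (p , u) = (e , p) , w∉ ∷ u

  pathList-snoc : ∀ x zs {y z} → PathList G (route x zs y) → E G y z →
                  PathList G (route x (zs ++ y ∷ []) z)
  pathList-snoc x [] (e , _) e′ = e , e′ , tt
  pathList-snoc x (w ∷ zs) (e , p) e′ = e , pathList-snoc w zs p e′

  snoc-path : ∀ {x zs y z} → E G y z → All (_≢ z) (route x zs y) →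
              SimplePath x zs y → SimplePath x (zs ++ y ∷ []) z
  snoc-path {x} {zs} e z∉ (p , u) =
    pathList-snoc x zs p e , AllPairs.++⁺ u ([] ∷ []) (All-map (_∷ []) z∉)

  no-detour : Acyclic G → ∀ {x z zs y} → E G y x → ¬ SimplePath x (z ∷ zs) y
  no-detour acyclic {x} {z} {zs} {y} e (p , u) = acyclic record
    { first = x ; rest = z ∷ zs ; last = y
    ; long = s≤s (s≤s (≤-trans (m≤n+m 1 (length zs)) (≤-reflexive (sym (length-++ zs)))))
    ; path = p ; distinct = u ; closes = e }

  flip-automorphism : ∀ σ → IsAutomorphism G σ → IsAutomorphism G (flip σ)
  flip-automorphism σ aut u v =
    (λ e → proj₂ (aut u′ v′) (subst₂ (E G) (sym (inverseʳ σ)) (sym (inverseʳ σ)) e)) ,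
    (λ e → subst₂ (E G) (inverseʳ σ) (inverseʳ σ) (proj₁ (aut u′ v′) e))
    where
    u′ = σ ⟨$⟩ˡ u
    v′ = σ ⟨$⟩ˡ v

  module _ (σ : Permutation′ n) (aut : IsAutomorphism G σ) where

    map-edge : ∀ {u v} → E G u v → E G (σ ⟨$⟩ʳ u) (σ ⟨$⟩ʳ v)
    map-edge = proj₁ (aut _ _)

    map-walk : ∀ {u v k} → Walk G u v k → Walk G (σ ⟨$⟩ʳ u) (σ ⟨$⟩ʳ v) k
    map-walk here = here
    map-walk (step e walk) = step (map-edge e) (map-walk walk)

  module _ (σ : Permutation′ n) (aut : IsAutomorphism G σ) where

    reflect-walk : ∀ {u v k} → Walk G (σ ⟨$⟩ʳ u) (σ ⟨$⟩ʳ v) k → Walk G u v k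
    reflect-walk {k = k} walk =
      subst₂ (λ x y → Walk G x y k) (inverseˡ σ) (inverseˡ σ)
             (map-walk (flip σ) (flip-automorphism σ aut) walk)

    map-dist : ∀ {u v d} → Dist G u v d → Dist G (σ ⟨$⟩ʳ u) (σ ⟨$⟩ʳ v) d
    map-dist (walk , shortest) = map-walk σ aut walk , λ k w → shortest k (reflect-walk w)

    map-ecc : ∀ {v e} → Ecc G v e → Ecc G (σ ⟨$⟩ʳ v) e
    map-ecc {v} (bounded , (u , far)) = bounded′ , (σ ⟨$⟩ʳ u , map-dist far)
      where
      bounded′ : ∀ u → ∃[ d ] (Dist G (σ ⟨$⟩ʳ v) u d × d ≤ _)
      bounded′ u with bounded (σ ⟨$⟩ˡ u)
      ... | d , dist , d≤e = d , subst (λ w → Dist G _ w d) (inverseʳ σ) (map-dist dist) , d≤e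

    map-center : ∀ {v} → InCenter G v → InCenter G (σ ⟨$⟩ʳ v)
    map-center (e , ecc , minimal) = e , map-ecc ecc , minimal

module Marked {n d : ℕ} (c : Fin n → Fin d) (x : Fin n) where

  fresh : Fin (suc d)
  fresh = fromℕ d

  mark : Fin n → Fin (suc d)
  mark y with y ≟ x
  ... | yes _ = fresh
  ... | no _ = inject₁ (c y)

  mark-x : mark x ≡ fresh
  mark-x with x ≟ x
  ... | yes _ = refl
  ... | no x≢x = contradiction refl x≢x

  mark≡fresh⇒≡x : ∀ {y} → mark y ≡ fresh → y ≡ x
  mark≡fresh⇒≡x {y} eq with y ≟ x
  ... | yes y≡x = y≡x
  ... | no _ = contradiction (sym eq) fromℕ≢inject₁

  mark≡⇒c≡ : ∀ {y z} → mark y ≡ mark z → c y ≡ c z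
  mark≡⇒c≡ {y} {z} eq with y ≟ x | z ≟ x
  ... | yes refl | yes refl = refl
  ... | yes _ | no _ = contradiction eq fromℕ≢inject₁
  ... | no _ | yes _ = contradiction (sym eq) fromℕ≢inject₁
  ... | no _ | no _ = inject₁-injective eq

module RootedAtEdge {n : ℕ} (G : Graph n) (connected : Connected G) (acyclic : Acyclic G)
                    {a b : Fin n} (a≢b : a ≢ b) (ab : E G a b) where

  -- In the application ab is the center of the tree.
  Central : Fin n → Set
  Central z = z ≡ a ⊎ z ≡ b

  central? : ∀ z → Dec (Central z)
  central? z = (z ≟ a) ⊎-dec (z ≟ b)

  central-adjacent : ∀ {x y} → Central x → Central y → x ≢ y → E G x y
  central-adjacent (inj₁ refl) (inj₁ refl) x≢y = contradiction refl x≢y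
  central-adjacent (inj₁ refl) (inj₂ refl) _ = ab
  central-adjacent (inj₂ refl) (inj₁ refl) _ = edge-sym G ab
  central-adjacent (inj₂ refl) (inj₂ refl) x≢y = contradiction refl x≢y

  central-≢⇒≡ : ∀ {x y z} → Central x → Central y → Central z → x ≢ y → x ≢ z → y ≡ z
  central-≢⇒≡ (inj₁ refl) (inj₁ refl) _ x≢y _ = contradiction refl x≢y
  central-≢⇒≡ (inj₂ refl) (inj₂ refl) _ x≢y _ = contradiction refl x≢y
  central-≢⇒≡ (inj₁ refl) _ (inj₁ refl) _ x≢z = contradiction refl x≢z
  central-≢⇒≡ (inj₂ refl) _ (inj₂ refl) _ x≢z = contradiction refl x≢z
  central-≢⇒≡ _ (inj₁ refl) (inj₁ refl) _ _ = refl
  central-≢⇒≡ _ (inj₂ refl) (inj₂ refl) _ _ = refl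

  opposite : Fin n → Fin n
  opposite z with z ≟ a
  ... | yes _ = b
  ... | no _ = a

  opposite-central : ∀ z → Central (opposite z)
  opposite-central z with z ≟ a
  ... | yes _ = inj₂ refl
  ... | no _ = inj₁ refl

  opposite-adjacent : ∀ {z} → Central z → E G z (opposite z)
  opposite-adjacent {z} central-z with z ≟ a | central-z
  ... | yes refl | _ = ab
  ... | no z≢a | inj₁ z≡a = contradiction z≡a z≢a
  ... | no _ | inj₂ refl = edge-sym G ab

  ToCenter : Fin n → ℕ → Set
  ToCenter v k = ∃[ z ] (Central z × Walk G v z k)

  toCenter? : ∀ v → Decidable (ToCenter v)
  toCenter? v k = any? (λ z → central? z ×-dec walk? G v z k)

  depth-spec : ∀ v → ∃[ m ] (ToCenter v m × (∀ {k} → ToCenter v k → m ≤ k))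
  depth-spec v = least (toCenter? v) (a , inj₁ refl , proj₂ (connected v a))

  depth : Fin n → ℕ
  depth v = proj₁ (depth-spec v)

  depth-walk : ∀ v → ToCenter v (depth v)
  depth-walk v = proj₁ (proj₂ (depth-spec v))

  depth-minimal : ∀ {v k} → ToCenter v k → depth v ≤ k
  depth-minimal {v} = proj₂ (proj₂ (depth-spec v))

  depth-step : ∀ {u v} → E G u v → depth v ≤ suc (depth u)
  depth-step {u} e with depth-walk u
  ... | z , central-z , walk = depth-minimal (z , central-z , step (edge-sym G e) walk)

  depth≡0⇒central : ∀ {v} → depth v ≡ 0 → Central v
  depth≡0⇒central {v} depth≡0 with subst (ToCenter v) depth≡0 (depth-walk v)
  ... | _ , central-z , here = central-z

  -- From a central vertex, the step across ab.
  towards : ∀ {v k} → ToCenter v k → Fin n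
  towards (z , _ , here) = opposite z
  towards (_ , _ , step {w = w} _ _) = w

  towards-adjacent : ∀ {v k} (r : ToCenter v k) → E G v (towards r)
  towards-adjacent (_ , central-z , here) = opposite-adjacent central-z
  towards-adjacent (_ , _ , step e _) = e

  towards-closer : ∀ {v k} (r : ToCenter v k) → ToCenter (towards r) (pred k)
  towards-closer (z , _ , here) = opposite z , opposite-central z , here
  towards-closer (z , central-z , step _ walk) = z , central-z , walk

  parent : Fin n → Fin n
  parent v = towards (depth-walk v)

  parent-adjacent : ∀ v → E G v (parent v)
  parent-adjacent v = towards-adjacent (depth-walk v)

  depth-parent : ∀ v → depth (parent v) ≡ pred (depth v)
  depth-parent v = ≤-antisym (depth-minimal (towards-closer (depth-walk v)))
                             (pred-mono-≤ (depth-step (edge-sym G (parent-adjacent v))))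

  depth-parent-suc : ∀ {v k} → depth v ≡ suc k → depth (parent v) ≡ k
  depth-parent-suc {v} depth-v = trans (depth-parent v) (cong pred depth-v)

  parent-closer : ∀ {v} → ¬ Central v → depth (parent v) < depth v
  parent-closer {v} non-central = closer (depth v) refl
    where
    closer : ∀ k → depth v ≡ k → depth (parent v) < depth v
    closer zero depth-v = contradiction (depth≡0⇒central depth-v) non-central
    closer (suc k) depth-v = ≤-reflexive (trans (cong suc (depth-parent-suc depth-v)) (sym depth-v))

  Below : ℕ → Fin n → Set
  Below k z = depth z ≤ k

  deeper⇒≢ : ∀ {k x z} → depth x ≡ suc k → Below k z → x ≢ z
  deeper⇒≢ depth-x below-z refl = <-irrefl refl (subst (_≤ _) depth-x below-z)

  -- Climb from x and y to their parents until these coincide or reach ab.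
  chain : ∀ k {x y} → depth x ≡ k → depth y ≡ k → x ≢ y →
          ∃[ zs ] (SimplePath G x zs y × All (Below k) (route G x zs y))
  chain-suc : ∀ k {x y} → depth x ≡ suc k → depth y ≡ suc k → x ≢ y →
              ∃₂ λ z zs → SimplePath G x (z ∷ zs) y × All (Below (suc k)) (route G x (z ∷ zs) y)

  chain zero depth-x depth-y x≢y =
    [] ,
    edge-path G x≢y (central-adjacent (depth≡0⇒central depth-x) (depth≡0⇒central depth-y) x≢y) ,
    ≤-reflexive depth-x ∷ ≤-reflexive depth-y ∷ []
  chain (suc k) depth-x depth-y x≢y with chain-suc k depth-x depth-y x≢y
  ... | z , zs , path , below = z ∷ zs , path , below

  chain-suc k {x} {y} depth-x depth-y x≢y with parent x ≟ parent y
  ... | yes px≡py =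
    parent x , [] ,
    cons-path G {zs = []} (parent-adjacent x) (x≢px ∷ x≢y ∷ []) (edge-path G px≢y px-y) ,
    ≤-reflexive depth-x ∷ m≤n⇒m≤1+n (≤-reflexive depth-px) ∷ ≤-reflexive depth-y ∷ []
    where
    depth-px = depth-parent-suc depth-x
    x≢px = deeper⇒≢ depth-x (≤-reflexive depth-px)
    px≢y = ≢-sym (deeper⇒≢ depth-y (≤-reflexive depth-px))
    px-y : E G (parent x) y
    px-y = subst (λ p → E G p y) (sym px≡py) (edge-sym G (parent-adjacent y))
  ... | no px≢py with chain k (depth-parent-suc depth-x) (depth-parent-suc depth-y) px≢py
  ...   | zs , path , below =
    parent x , zs ++ parent y ∷ [] ,
    cons-path G (parent-adjacent x) (All.++⁺ (All-map (deeper⇒≢ depth-x) below) (x≢y ∷ []))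
      (snoc-path G (edge-sym G (parent-adjacent y))
                   (All-map (≢-sym ∘ deeper⇒≢ depth-y) below) path) ,
    ≤-reflexive depth-x ∷ All.++⁺ (All-map m≤n⇒m≤1+n below) (≤-reflexive depth-y ∷ [])

  closer-neighbor-unique : ∀ k {v w w′} → depth v ≡ k → E G v w → E G v w′ →
                            depth w ≡ pred k → depth w′ ≡ pred k → w ≡ w′
  closer-neighbor-unique zero depth-v e e′ depth-w depth-w′ =
    central-≢⇒≡ (depth≡0⇒central depth-v) (depth≡0⇒central depth-w) (depth≡0⇒central depth-w′)
                (adjacent⇒≢ G e) (adjacent⇒≢ G e′)
  closer-neighbor-unique (suc k) {w = w} {w′} depth-v e e′ depth-w depth-w′ with w ≟ w′
  ... | yes w≡w′ = w≡w′
  ... | no w≢w′ with chain k depth-w depth-w′ w≢w′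
  ...   | _ , path , below =
    contradiction (cons-path G e (All-map (deeper⇒≢ depth-v) below) path)
                  (no-detour G acyclic (edge-sym G e′))

  parent-unique : ∀ {v w} → E G v w → depth w ≡ pred (depth v) → w ≡ parent v
  parent-unique {v} e depth-w =
    closer-neighbor-unique (depth v) refl e (parent-adjacent v) depth-w (depth-parent v)

  level-edge : ∀ k {u v} → E G u v → depth u ≡ k → depth v ≡ k → k ≡ 0
  level-edge zero _ _ _ = refl
  level-edge (suc k) e depth-u depth-v with chain-suc k depth-u depth-v (adjacent⇒≢ G e)
  ... | _ , _ , path , _ = contradiction path (no-detour G acyclic (edge-sym G e))

  adjacent-depths : ∀ {u v} → E G u v → depth v ≡ pred (depth u) ⊎ depth u ≡ pred (depth v)
  adjacent-depths {u} {v} e with <-cmp (depth u) (depth v)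
  ... | tri< u<v _ _ = inj₂ (cong pred (sym (≤-antisym (depth-step e) u<v)))
  ... | tri> _ _ v<u = inj₁ (cong pred (sym (≤-antisym (depth-step (edge-sym G e)) v<u)))
  ... | tri≈ _ u≡v _ = inj₁ (trans (sym u≡v) (trans depth-u≡0 (cong pred (sym depth-u≡0))))
    where
    depth-u≡0 = level-edge (depth u) e refl (sym u≡v)

  edge-to-parent : ∀ {u v} → E G u v → v ≡ parent u ⊎ u ≡ parent v
  edge-to-parent e = Sum.map (parent-unique e) (parent-unique (edge-sym G e)) (adjacent-depths e)

  central-closure : (∀ x → E G a x ⊎ E G b x → Central x) → ∀ v → Central v
  central-closure closed v = stays (inj₁ refl) (proj₂ (connected a v))
    where
    stays : ∀ {w v k} → Central w → Walk G w v k → Central v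
    stays central-w here = central-w
    stays (inj₁ refl) (step e walk) = stays (closed _ (inj₁ e)) walk
    stays (inj₂ refl) (step e walk) = stays (closed _ (inj₂ e)) walk

  no-common-neighbor : ∀ {x} → ¬ Central x → E G a x → E G b x → ⊥
  no-common-neighbor outer-x ax bx =
    no-detour G acyclic {zs = []} (edge-sym G ab)
      (cons-path G {zs = []} ax (a≢x ∷ a≢b ∷ []) (edge-path G x≢b (edge-sym G bx)))
    where
    a≢x = λ a≡x → outer-x (inj₁ (sym a≡x))
    x≢b = λ x≡b → outer-x (inj₂ x≡b)

  -- When the graph is the single edge ab, the transposition of a and b preserves every edge labelling.
  all-central⇒no-distinguishing-edge-labelling : (∀ v → Central v) → ∀ {r} → ¬ HasDistEdgeLabelling G r
  all-central⇒no-distinguishing-edge-labelling all-central ((ℓ , ℓ-sym) , distinguishing) =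
    distinguishing τ automorphism (a , λ τa≡a → a≢b (trans (sym τa≡a) τa)) preserved
    where
    τ = transpose a b

    τa : τ ⟨$⟩ʳ a ≡ b
    τa rewrite dec-true (a ≟ a) refl = refl

    τb : τ ⟨$⟩ʳ b ≡ a
    τb rewrite dec-false (b ≟ a) (a≢b ∘ sym) | dec-true (b ≟ b) refl = refl

    swaps : ∀ {u v} → u ≢ v → τ ⟨$⟩ʳ u ≡ v
    swaps {u} {v} u≢v with all-central u | all-central v
    ... | inj₁ refl | inj₁ refl = contradiction refl u≢v
    ... | inj₁ refl | inj₂ refl = τa
    ... | inj₂ refl | inj₁ refl = τb
    ... | inj₂ refl | inj₂ refl = contradiction refl u≢v

    adjacent : ∀ {u v} → u ≢ v → E G u v
    adjacent = central-adjacent (all-central _) (all-central _)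

    automorphism : IsAutomorphism G τ
    automorphism u v = (λ e → adjacent (adjacent⇒≢ G e ∘ Injection.injective (↔⇒↣ τ)))
                     , (λ e → adjacent (adjacent⇒≢ G e ∘ cong (τ ⟨$⟩ʳ_)))

    preserved : PreservesEdgeLabelling G (ℓ , ℓ-sym) τ
    preserved u v e = subst₂ (λ p q → ℓ p q ≡ ℓ u v) (sym (swaps (adjacent⇒≢ G e)))
                        (sym (swaps (≢-sym (adjacent⇒≢ G e)))) (sym (ℓ-sym u v e))

  center-has-outer-neighbor : ∀ {r} → HasDistEdgeLabelling G r →
                              ∃[ x ] (¬ Central x × (E G a x ⊎ E G b x))
  center-has-outer-neighbor labelling
    with any? (λ x → ¬? (central? x) ×-dec (T? (Graph.adj G a x) ⊎-dec T? (Graph.adj G b x)))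
  ... | yes outer = outer
  ... | no none = contradiction labelling
        (all-central⇒no-distinguishing-edge-labelling (central-closure closed))
    where
    closed : ∀ x → E G a x ⊎ E G b x → Central x
    closed x e with central? x
    ... | yes central-x = central-x
    ... | no non-central = contradiction (x , non-central , e) none

  module _ (center-stable : ∀ σ → IsAutomorphism G σ → ∀ {z} → Central z → Central (σ ⟨$⟩ʳ z)) where

    depth-map-≤ : ∀ σ → IsAutomorphism G σ → ∀ v → depth (σ ⟨$⟩ʳ v) ≤ depth v
    depth-map-≤ σ aut v with depth-walk v
    ... | z , central-z , walk =
      depth-minimal (σ ⟨$⟩ʳ z , center-stable σ aut central-z , map-walk G σ aut walk)

    depth-invariant : ∀ σ → IsAutomorphism G σ → ∀ v → depth (σ ⟨$⟩ʳ v) ≡ depth v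
    depth-invariant σ aut v = ≤-antisym (depth-map-≤ σ aut v)
      (subst (λ u → depth u ≤ depth (σ ⟨$⟩ʳ v)) (inverseˡ σ)
             (depth-map-≤ (flip σ) (flip-automorphism G σ aut) (σ ⟨$⟩ʳ v)))

    parent-commutes : ∀ σ → IsAutomorphism G σ → ∀ v → parent (σ ⟨$⟩ʳ v) ≡ σ ⟨$⟩ʳ parent v
    parent-commutes σ aut v = sym (parent-unique (map-edge G σ aut (parent-adjacent v)) (begin
      depth (σ ⟨$⟩ʳ parent v)  ≡⟨ depth-invariant σ aut (parent v) ⟩
      depth (parent v)         ≡⟨ depth-parent v ⟩
      pred (depth v)           ≡⟨ cong pred (depth-invariant σ aut v) ⟨
      pred (depth (σ ⟨$⟩ʳ v))  ∎))
      where open ≡-Reasoning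

    fixes-or-swaps : ∀ σ → IsAutomorphism G σ →
                     (σ ⟨$⟩ʳ a ≡ a × σ ⟨$⟩ʳ b ≡ b) ⊎ (σ ⟨$⟩ʳ a ≡ b × σ ⟨$⟩ʳ b ≡ a)
    fixes-or-swaps σ aut with center-stable σ aut (inj₁ refl) | center-stable σ aut (inj₂ refl)
    ... | inj₁ σa≡a | inj₁ σb≡a =
      contradiction (Injection.injective (↔⇒↣ σ) (trans σa≡a (sym σb≡a))) a≢b
    ... | inj₁ σa≡a | inj₂ σb≡b = inj₁ (σa≡a , σb≡b)
    ... | inj₂ σa≡b | inj₁ σb≡a = inj₂ (σa≡b , σb≡a)
    ... | inj₂ σa≡b | inj₂ σb≡b =
      contradiction (Injection.injective (↔⇒↣ σ) (trans σa≡b (sym σb≡b))) a≢b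

    -- Every edge is the parent edge of one of its endpoints.
    edge⇒vertex-distinguishing : ∀ {r} → HasDistEdgeLabelling G r → HasDistVertexLabelling G r
    edge⇒vertex-distinguishing ((ℓ , ℓ-sym) , distinguishing) = c , c-distinguishing
      where
      c : Fin n → Fin _
      c v = ℓ v (parent v)

      c-distinguishing : DistinguishingVertexLabelling G c
      c-distinguishing σ aut non-identity c-preserved =
        distinguishing σ aut non-identity ℓ-preserved
        where
        σ⁺ = σ ⟨$⟩ʳ_

        parent-edge-preserved : ∀ v → ℓ (σ⁺ v) (σ⁺ (parent v)) ≡ ℓ v (parent v)
        parent-edge-preserved v =
          trans (cong (ℓ (σ⁺ v)) (sym (parent-commutes σ aut v))) (c-preserved v)

        ℓ-preserved : PreservesEdgeLabelling G (ℓ , ℓ-sym) σ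
        ℓ-preserved u v e with edge-to-parent e
        ... | inj₁ refl = parent-edge-preserved u
        ... | inj₂ refl = begin
          ℓ (σ⁺ (parent v)) (σ⁺ v)  ≡⟨ ℓ-sym _ _ (map-edge G σ aut e) ⟩
          ℓ (σ⁺ v) (σ⁺ (parent v))  ≡⟨ parent-edge-preserved v ⟩
          ℓ v (parent v)            ≡⟨ ℓ-sym _ _ (parent-adjacent v) ⟩
          ℓ (parent v) v            ∎
          where open ≡-Reasoning

    -- Give an edge the mark of its endpoint farther from ab, and ab itself the fresh label;
    -- x is then the only vertex whose parent edge carries the fresh label.
    vertex⇒edge-distinguishing : ∀ {d} → ∃[ x ] (¬ Central x × (E G a x ⊎ E G b x)) →
                                 HasDistVertexLabelling G d → HasDistEdgeLabelling G (suc d)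
    vertex⇒edge-distinguishing {d} (x , outer-x , x-adjacent) (c , c-distinguishing) =
      (L , λ u v _ → L-sym u v) , L-distinguishing
      where
      open Marked c x

      L : Fin n → Fin n → Fin (suc d)
      L u v with <-cmp (depth u) (depth v)
      ... | tri< _ _ _ = mark v
      ... | tri≈ _ _ _ = fresh
      ... | tri> _ _ _ = mark u

      L-sym : ∀ u v → L u v ≡ L v u
      L-sym u v with <-cmp (depth u) (depth v) | <-cmp (depth v) (depth u)
      ... | tri< _ _ _ | tri> _ _ _ = refl
      ... | tri≈ _ _ _ | tri≈ _ _ _ = refl
      ... | tri> _ _ _ | tri< _ _ _ = refl
      ... | tri< u<v _ _ | tri< _ _ ¬u<v = contradiction u<v ¬u<v
      ... | tri< u<v _ _ | tri≈ _ _ ¬u<v = contradiction u<v ¬u<v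
      ... | tri≈ _ u≡v _ | tri< _ v≢u _ = contradiction (sym u≡v) v≢u
      ... | tri≈ _ u≡v _ | tri> _ v≢u _ = contradiction (sym u≡v) v≢u
      ... | tri> _ _ v<u | tri≈ ¬v<u _ _ = contradiction v<u ¬v<u
      ... | tri> _ _ v<u | tri> ¬v<u _ _ = contradiction v<u ¬v<u

      L-deeper : ∀ {u v} → depth v < depth u → L u v ≡ mark u
      L-deeper {u} {v} v<u with <-cmp (depth u) (depth v)
      ... | tri< _ _ ¬v<u = contradiction v<u ¬v<u
      ... | tri≈ _ _ ¬v<u = contradiction v<u ¬v<u
      ... | tri> _ _ _ = refl

      L-distinguishing : DistinguishingEdgeLabelling G (L , λ u v _ → L-sym u v)
      L-distinguishing ρ aut non-identity L-preserved = refute (fixes-or-swaps ρ aut) x-adjacent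
        where
        ρ⁺ = ρ ⟨$⟩ʳ_

        mark-preserved : ∀ {v} → ¬ Central v → mark (ρ⁺ v) ≡ mark v
        mark-preserved {v} outer-v = begin
          mark (ρ⁺ v)                 ≡⟨ L-deeper ρ-closer ⟨
          L (ρ⁺ v) (ρ⁺ (parent v))    ≡⟨ L-preserved v (parent v) (parent-adjacent v) ⟩
          L v (parent v)              ≡⟨ L-deeper (parent-closer outer-v) ⟩
          mark v                      ∎
          where
          open ≡-Reasoning
          ρ-closer : depth (ρ⁺ (parent v)) < depth (ρ⁺ v)
          ρ-closer = subst₂ _<_ (sym (depth-invariant ρ aut (parent v)))
                                (sym (depth-invariant ρ aut v))
                                (parent-closer outer-v)

        ρx≡x : ρ⁺ x ≡ x
        ρx≡x = mark≡fresh⇒≡x (trans (mark-preserved outer-x) mark-x)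

        c-preserved : ρ⁺ a ≡ a → ρ⁺ b ≡ b → PreservesVertexLabelling G c ρ
        c-preserved ρa≡a ρb≡b v with central? v
        ... | yes (inj₁ refl) = cong c ρa≡a
        ... | yes (inj₂ refl) = cong c ρb≡b
        ... | no outer-v = mark≡⇒c≡ (mark-preserved outer-v)

        refute : (ρ⁺ a ≡ a × ρ⁺ b ≡ b) ⊎ (ρ⁺ a ≡ b × ρ⁺ b ≡ a) → E G a x ⊎ E G b x → ⊥
        refute (inj₁ (ρa≡a , ρb≡b)) _ = c-distinguishing ρ aut non-identity (c-preserved ρa≡a ρb≡b)
        refute (inj₂ (ρa≡b , _)) (inj₁ ax) =
          no-common-neighbor outer-x ax (subst₂ (E G) ρa≡b ρx≡x (map-edge G ρ aut ax))
        refute (inj₂ (_ , ρb≡a)) (inj₂ bx) =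
          no-common-neighbor outer-x (subst₂ (E G) ρb≡a ρx≡x (map-edge G ρ aut bx)) bx

lemma2 : ∀ {n : ℕ} (T : Graph n) → IsTree T → Bicentric T →
         ∀ (d d′ : ℕ) → IsDistinguishingNumber T d → IsDistinguishingIndex T d′ →
         d ≤ d′ × d′ ≤ suc d
lemma2 T (connected , acyclic) (a , b , a≢b , ab , a-central , b-central , center-is-ab) d d′
       (vertex-labelling , d-least) (edge-labelling , d′-least) =
  d-least d′ (edge⇒vertex-distinguishing center-stable edge-labelling) ,
  d′-least (suc d) (vertex⇒edge-distinguishing center-stable
                      (center-has-outer-neighbor edge-labelling) vertex-labelling)
  where
  open RootedAtEdge T connected acyclic a≢b ab

  in-center : ∀ {z} → Central z → InCenter T z
  in-center (inj₁ refl) = a-central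
  in-center (inj₂ refl) = b-central

  center-stable : ∀ σ → IsAutomorphism T σ → ∀ {z} → Central z → Central (σ ⟨$⟩ʳ z)
  center-stable σ aut central-z = center-is-ab _ (map-center T σ aut (in-center central-z))
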